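{- Let $r\ge 2$ and let $GT(r)$ be the glued binary tree of depth $r$, with copies $T_r^{(1)},T_r^{(2)}$, quasi-leaf set $L$, and $V_r^{(1)}=V(T_r^{(1)})\setminus L$. Let $S$ be a general position set of $GT(r)$ with $|S\cap V_r^{(1)}|\ge 2$. Then to each vertex $v\in S\cap V_r^{(1)}$ one can assign a pair of quasi-leaves lying in $T_v$ and not belonging to $S$, in such a way that the pairs assigned to distinct vertices of $S\cap V_r^{(1)}$ are pairwise disjoint.
   Context: A perfect binary tree of depth $r$ is a rooted tree in which every non-leaf vertex has exactly 2 children and all leaves have depth $r$. $GT(r)$ is obtained from two copies $T_r^{(1)},T_r^{(2)}$ of it by identifying each leaf of $T_r^{(1)}$ with the corresponding leaf (under the natural isomorphism) of $T_r^{(2)}$; the identified vertices are the quasi-leaves, forming the set $L$. For a vertex $u$ of $T_r^{(i)}$, $T_u$ denotes the subtree of $T_r^{(i)}$ rooted at $u$ consisting of $u$ and all its descendants. For $S\subseteq V(G)$, two vertices $u,v$ are $S$-positionable if every shortest $u,v$-path $P$ satisfies $V(P)\cap S\subseteq\{u,v\}$; $S$ is a general position set if every two vertices of $S$ are $S$-positionable. -}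

module Defs where

open import Data.Nat using (ℕ; zero; suc; _<_; _≤_)
open import Data.Bool using (Bool)
open import Data.List using (List; []; _∷_; length; _++_)
open import Data.Product using (Σ; ∃; _×_; _,_)
open import Data.Sum using (_⊎_)
open import Relation.Binary.PropositionalEquality using (_≡_)
open import Relation.Nullary using (¬_)
open import Data.Unit using (⊤)
open import Data.Empty using (⊥)

-- A vertex of the perfect binary tree T_r is encoded by its address: the list
-- of left/right choices from the root, stored in REVERSE order (the most
-- recent choice is the head), so the children of  xs  are  b ∷ xs .  Vertices of depth < r exist in two copies;
-- vertices of depth r are the quasi-leaves (shared by both copies).

data Copy : Set where
  one two : Copy

data V (r : ℕ) : Set where
  node  : (c : Copy) (xs : List Bool) → .(length xs < r) → V r
  qleaf : (xs : List Bool) → .(length xs ≡ r) → V r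

data Edge {r : ℕ} : V r → V r → Set where
  toNode : ∀ c b xs .(p : length xs < r) .(q : length (b ∷ xs) < r) →
           Edge (node c xs p) (node c (b ∷ xs) q)
  toLeaf : ∀ c b xs .(p : length xs < r) .(q : length (b ∷ xs) ≡ r) →
           Edge (node c xs p) (qleaf (b ∷ xs) q)

Adj : ∀ {r} → V r → V r → Set
Adj u v = Edge u v ⊎ Edge v u

data Walk {r : ℕ} : V r → V r → ℕ → Set where
  here : ∀ {u} → Walk u u 0
  step : ∀ {u w v n} → Adj u w → Walk w v n → Walk u v (suc n)

data _∈W_ {r : ℕ} (x : V r) : ∀ {u v n} → Walk u v n → Set where
  at-start : ∀ {u v n} {p : Walk u v n} → x ≡ u → x ∈W p
  later    : ∀ {u w v n} {e : Adj u w} {p : Walk w v n} → x ∈W p → x ∈W step e p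

IsShortest : ∀ {r} {u v : V r} {n} → Walk u v n → Set
IsShortest {u = u} {v} {n} _ = ∀ m → Walk u v m → n ≤ m

Positionable : ∀ {r} → (V r → Set) → V r → V r → Set
Positionable {r} S u v =
  ∀ n (P : Walk u v n) → IsShortest P →
    ∀ x → x ∈W P → S x → (x ≡ u) ⊎ (x ≡ v)

GeneralPosition : ∀ {r} → (V r → Set) → Set
GeneralPosition {r} S = ∀ u v → S u → S v → Positionable S u v

InV1 : ∀ {r} → V r → Set
InV1 (node one _ _) = ⊤
InV1 _              = ⊥

IsQuasiLeaf : ∀ {r} → V r → Set
IsQuasiLeaf (qleaf _ _) = ⊤
IsQuasiLeaf _           = ⊥

-- x lies in T_v (v together with all its descendants, within v's copy;
-- quasi-leaves are descendants of the depth-(r-1) vertices of both copies)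
InSubtree : ∀ {r} → V r → V r → Set
InSubtree (node c xs _) (node c' ys _) = (c ≡ c') × ∃ λ zs → ys ≡ zs ++ xs
InSubtree (node c xs _) (qleaf ys _)   = ∃ λ zs → ys ≡ zs ++ xs
InSubtree (qleaf xs _)  (qleaf ys _)   = xs ≡ ys
InSubtree (qleaf _ _)   (node _ _ _)   = ⊥

{-# OPTIONS --safe #-}
-- Both copies of T_r project onto T_r, so the tree distance between addresses bounds the length
-- of every walk in GT(r) from below. Hence a path in T_r^(1) that climbs from one vertex to its
-- meet with another and descends again is shortest, so its ends cannot both lie in S together
-- with an inner vertex.
-- For v ∈ S ∩ V_r^(1) pick another s ∈ S ∩ V_r^(1). If s lies below v through the child z,
-- take two quasi-leaves below the other child of v; otherwise any two quasi-leaves below v.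
-- Either way v separates s from every vertex strictly between v and a chosen quasi-leaf, so
-- none of these vertices, nor the quasi-leaf itself, is in S. If distinct v, v′ shared a
-- quasi-leaf, one of them, say v′, would lie strictly between the other and that quasi-leaf,
-- contradicting v′ ∈ S.
module Submission where

open import Defs
open import Data.Bool using (Bool; true; false; not)
import Data.Bool as Bool
open import Data.Bool.Properties using (not-¬)
open import Data.Empty using (⊥-elim)
import Data.Empty.Irrelevant as Irrelevant
open import Data.List using (List; []; _∷_; _++_; _∷ʳ_; [_]; length; reverse; replicate; initLast; _∷ʳ′_)
open import Data.List.Properties
  using (≡-dec; ∷-injectiveˡ; ∷-injectiveʳ; length-++; length-++-≤ʳ; length-replicate;
         ++-assoc; ∷ʳ-++; ++-identityʳ; ++-identityˡ-unique; ++-cancelˡ; ++-cancelʳ; ++-conicalʳ;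
         length-reverse; reverse-++; reverse-involutive; reverse-injective; unfold-reverse)
open import Data.Nat using (ℕ; suc; _+_; _∸_; _≤_; _<_; _≤?_; z≤n; s≤s)
open import Data.Nat.Properties
  using (≤-refl; ≤-reflexive; ≤-trans; <-trans; n<1+n; m≤n+m; <⇒≢; +-assoc; +-comm; +-identityʳ; m∸n+n≡m)
open import Data.Product using (Σ; ∃; ∃₂; _×_; _,_; proj₁; proj₂)
open import Data.Sum using (_⊎_; inj₁; inj₂; swap)
open import Data.Unit using (tt)
open import Function using (_∘_)
open import Relation.Binary.PropositionalEquality
  using (_≡_; _≢_; refl; sym; trans; cong; cong₂; subst; subst₂; module ≡-Reasoning)
open import Relation.Nullary using (¬_; yes; no)
open import Relation.Nullary.Decidable using (recompute)

length-∷ʳ : ∀ {a} {A : Set a} (xs : List A) x → length (xs ∷ʳ x) ≡ suc (length xs)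
length-∷ʳ xs x = trans (length-++ xs) (+-comm (length xs) 1)

dist : List Bool → List Bool → ℕ
dist []           ys           = length ys
dist (x ∷ xs)     []           = suc (length xs)
dist (true ∷ xs)  (true ∷ ys)  = dist xs ys
dist (false ∷ xs) (false ∷ ys) = dist xs ys
dist (true ∷ xs)  (false ∷ ys) = suc (length xs) + suc (length ys)
dist (false ∷ xs) (true ∷ ys)  = suc (length xs) + suc (length ys)

dist-self : ∀ xs → dist xs xs ≡ 0
dist-self []           = refl
dist-self (true ∷ xs)  = dist-self xs
dist-self (false ∷ xs) = dist-self xs

dist-++ˡ : ∀ ks xs ys → dist (ks ++ xs) (ks ++ ys) ≡ dist xs ys
dist-++ˡ []           xs ys = refl
dist-++ˡ (true ∷ ks)  xs ys = dist-++ˡ ks xs ys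
dist-++ˡ (false ∷ ks) xs ys = dist-++ˡ ks xs ys

dist-∷ʳ-≤ : ∀ xs b ys → dist (xs ∷ʳ b) ys ≤ suc (dist xs ys)
dist-∷ʳ-≤ []           b     []            = ≤-refl
dist-∷ʳ-≤ []           true  (true ∷ ys)   = m≤n+m _ 2
dist-∷ʳ-≤ []           true  (false ∷ ys)  = ≤-refl
dist-∷ʳ-≤ []           false (true ∷ ys)   = ≤-refl
dist-∷ʳ-≤ []           false (false ∷ ys)  = m≤n+m _ 2
dist-∷ʳ-≤ (x ∷ xs)     b     []            rewrite length-∷ʳ xs b = ≤-refl
dist-∷ʳ-≤ (true ∷ xs)  b     (true ∷ ys)   = dist-∷ʳ-≤ xs b ys
dist-∷ʳ-≤ (false ∷ xs) b     (false ∷ ys)  = dist-∷ʳ-≤ xs b ys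
dist-∷ʳ-≤ (true ∷ xs)  b     (false ∷ ys)  rewrite length-∷ʳ xs b = ≤-refl
dist-∷ʳ-≤ (false ∷ xs) b     (true ∷ ys)   rewrite length-∷ʳ xs b = ≤-refl

dist-≤-∷ʳ : ∀ xs b ys → dist xs ys ≤ suc (dist (xs ∷ʳ b) ys)
dist-≤-∷ʳ []           b     []            = z≤n
dist-≤-∷ʳ []           true  (true ∷ ys)   = ≤-refl
dist-≤-∷ʳ []           true  (false ∷ ys)  = m≤n+m _ 2
dist-≤-∷ʳ []           false (true ∷ ys)   = m≤n+m _ 2
dist-≤-∷ʳ []           false (false ∷ ys)  = ≤-refl
dist-≤-∷ʳ (x ∷ xs)     b     []            rewrite length-∷ʳ xs b = m≤n+m _ 2
dist-≤-∷ʳ (true ∷ xs)  b     (true ∷ ys)   = dist-≤-∷ʳ xs b ys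
dist-≤-∷ʳ (false ∷ xs) b     (false ∷ ys)  = dist-≤-∷ʳ xs b ys
dist-≤-∷ʳ (true ∷ xs)  b     (false ∷ ys)  rewrite length-∷ʳ xs b = m≤n+m _ 2
dist-≤-∷ʳ (false ∷ xs) b     (true ∷ ys)   rewrite length-∷ʳ xs b = m≤n+m _ 2

data Diverge : List Bool → List Bool → Set where
  nilˡ : ∀ {ys} → Diverge [] ys
  nilʳ : ∀ {xs} → Diverge xs []
  fork : ∀ {x y xs ys} → x ≢ y → Diverge (x ∷ xs) (y ∷ ys)

dist-diverge : ∀ {xs ys} → Diverge xs ys → dist xs ys ≡ length xs + length ys
dist-diverge nilˡ                           = refl
dist-diverge {[]}     nilʳ                  = refl
dist-diverge {x ∷ xs} nilʳ                  = sym (+-identityʳ _)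
dist-diverge {true ∷ _}  {true ∷ _}  (fork x≢y) = ⊥-elim (x≢y refl)
dist-diverge {false ∷ _} {false ∷ _} (fork x≢y) = ⊥-elim (x≢y refl)
dist-diverge {true ∷ _}  {false ∷ _} (fork _)   = refl
dist-diverge {false ∷ _} {true ∷ _}  (fork _)   = refl

Diverge-++⁻ : ∀ {xs ys} zs → Diverge (xs ++ zs) ys → Diverge xs ys
Diverge-++⁻ {[]}    _ _        = nilˡ
Diverge-++⁻ {_ ∷ _} _ nilʳ     = nilʳ
Diverge-++⁻ {_ ∷ _} _ (fork d) = fork d

Diverge-++⁺ : ∀ {xs ys} zs → Diverge xs ys → xs ≢ [] → Diverge (xs ++ zs) ys
Diverge-++⁺ _ nilˡ     xs≢[] = ⊥-elim (xs≢[] refl)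
Diverge-++⁺ _ nilʳ     _     = nilʳ
Diverge-++⁺ _ (fork d) _     = fork d

commonPrefix : ∀ xs ys → ∃₂ λ ks xs′ → ∃ λ ys′ →
  xs ≡ ks ++ xs′ × ys ≡ ks ++ ys′ × Diverge xs′ ys′
commonPrefix []       ys       = [] , [] , ys , refl , refl , nilˡ
commonPrefix (x ∷ xs) []       = [] , x ∷ xs , [] , refl , refl , nilʳ
commonPrefix (x ∷ xs) (y ∷ ys) with x Bool.≟ y
... | no x≢y = [] , x ∷ xs , y ∷ ys , refl , refl , fork x≢y
... | yes refl with commonPrefix xs ys
...   | ks , xs′ , ys′ , refl , refl , d = x ∷ ks , xs′ , ys′ , refl , refl , d

-- Addresses list the most recent choice first, so the meet of two vertices is their longest
-- common suffix; e and a are the branches from the meet k towards xs and ys.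
data Position (xs ys : List Bool) : Set where
  same  : xs ≡ ys → Position xs ys
  below : ∀ zs z → ys ≡ (zs ∷ʳ z) ++ xs → Position xs ys
  apart : ∀ k e a → xs ≡ e ++ k → ys ≡ a ++ k → e ≢ [] →
          Diverge (reverse e) (reverse a) → Position xs ys

meet : ∀ xs ys → ∃₂ λ k e → ∃ λ a → xs ≡ e ++ k × ys ≡ a ++ k × Diverge (reverse e) (reverse a)
meet xs ys with commonPrefix (reverse xs) (reverse ys)
... | K , E , A , xs≡ , ys≡ , d =
  reverse K , reverse E , reverse A , unreverse E xs≡ , unreverse A ys≡ ,
  subst₂ Diverge (sym (reverse-involutive E)) (sym (reverse-involutive A)) d
  where
  unreverse : ∀ {zs} Z → reverse zs ≡ K ++ Z → zs ≡ reverse Z ++ reverse K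
  unreverse {zs} Z eq = trans (sym (reverse-involutive zs)) (trans (cong reverse eq) (reverse-++ K Z))

position : ∀ xs ys → Position xs ys
position xs ys with meet xs ys
... | k , e@(_ ∷ _) , a , refl , refl , d = apart k e a refl refl (λ ()) d
... | k , [] , a , refl , refl , _ with initLast a
...   | []       = same refl
...   | zs ∷ʳ′ z = below zs z refl

addr : ∀ {r} → V r → List Bool
addr (node _ xs _) = xs
addr (qleaf xs _)  = xs

fromRoot : ∀ {r} → V r → List Bool
fromRoot v = reverse (addr v)

InT1 : ∀ {r} → V r → Set
InT1 v = InV1 v ⊎ IsQuasiLeaf v

InV1-addr-injective : ∀ {r} {u w : V r} → InV1 u → InV1 w → addr u ≡ addr w → u ≡ w
InV1-addr-injective {u = node one _ _} {node one _ _} _ _ refl = refl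

fromRoot-child : ∀ {r} {u w : V r} → Edge u w → ∃ λ b → fromRoot w ≡ fromRoot u ∷ʳ b
fromRoot-child (toNode _ b xs _ _) = b , unfold-reverse b xs
fromRoot-child (toLeaf _ b xs _ _) = b , unfold-reverse b xs

dist-Adj : ∀ {r} {u w : V r} zs → Adj u w → dist (fromRoot u) zs ≤ suc (dist (fromRoot w) zs)
dist-Adj {u = u} zs (inj₁ u→w) with b , eq ← fromRoot-child u→w rewrite eq = dist-≤-∷ʳ (fromRoot u) b zs
dist-Adj {w = w} zs (inj₂ w→u) with b , eq ← fromRoot-child w→u rewrite eq = dist-∷ʳ-≤ (fromRoot w) b zs

dist-≤-length : ∀ {r} {u v : V r} {n} → Walk u v n → dist (fromRoot u) (fromRoot v) ≤ n
dist-≤-length {u = u} here       = ≤-reflexive (dist-self (fromRoot u))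
dist-≤-length {v = v} (step e p) = ≤-trans (dist-Adj (fromRoot v) e) (s≤s (dist-≤-length p))

dist-shortest : ∀ {r} {u v : V r} {n} (P : Walk u v n) → dist (fromRoot u) (fromRoot v) ≡ n → IsShortest P
dist-shortest P eq m Q = subst (_≤ m) eq (dist-≤-length Q)

_++W_ : ∀ {r} {u v w : V r} {m n} → Walk u v m → Walk v w n → Walk u w (m + n)
here     ++W Q = Q
step e P ++W Q = step e (P ++W Q)

∈W-++ʳ : ∀ {r} {u v w x : V r} {m n} (P : Walk u v m) {Q : Walk v w n} → x ∈W Q → x ∈W (P ++W Q)
∈W-++ʳ here       x∈Q = x∈Q
∈W-++ʳ (step e P) x∈Q = later (∈W-++ʳ P x∈Q)

snocW : ∀ {r} {u v w : V r} {n} → Walk u v n → Adj v w → Walk u w (suc n)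
snocW here       e = step e here
snocW (step d P) e = step d (snocW P e)

reverseW : ∀ {r} {u v : V r} {n} → Walk u v n → Walk v u n
reverseW here       = here
reverseW (step e P) = snocW (reverseW P) (swap e)

ascend : ∀ {r} c k .(hk : length k < r) (y : V r) → InT1 y → addr y ≡ c ++ k →
         Walk y (node one k hk) (length c)
ascend []      k hk (node one _ _) _ refl = here
ascend []      k hk (qleaf _ h)    _ refl = Irrelevant.⊥-elim (<⇒≢ hk h)
ascend (b ∷ c) k hk (node one _ h) _ refl =
  step (inj₂ (toNode one b (c ++ k) (<-trans (n<1+n _) h) h)) (ascend c k hk _ (inj₁ tt) refl)
ascend (b ∷ c) k hk (qleaf _ h)    _ refl =
  step (inj₂ (toLeaf one b (c ++ k) (≤-reflexive h) h)) (ascend c k hk _ (inj₁ tt) refl)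
ascend _       _ _  (node two _ _) (inj₁ ()) _
ascend _       _ _  (node two _ _) (inj₂ ()) _

dist-branches : ∀ e a k → Diverge (reverse e) (reverse a) →
                dist (reverse (e ++ k)) (reverse (a ++ k)) ≡ length e + length a
dist-branches e a k d = begin
  dist (reverse (e ++ k)) (reverse (a ++ k))
    ≡⟨ cong₂ dist (reverse-++ e k) (reverse-++ a k) ⟩
  dist (reverse k ++ reverse e) (reverse k ++ reverse a)
    ≡⟨ dist-++ˡ (reverse k) (reverse e) (reverse a) ⟩
  dist (reverse e) (reverse a)
    ≡⟨ dist-diverge d ⟩
  length (reverse e) + length (reverse a)
    ≡⟨ cong₂ _+_ (length-reverse e) (length-reverse a) ⟩
  length e + length a ∎
  where open ≡-Reasoning

ClearBelow : ∀ {r} → (V r → Set) → List Bool → List Bool → Set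
ClearBelow {r} S xs ℓ =
  ∀ (y : V r) c t → InT1 y → c ≢ [] → addr y ≡ c ++ xs → ℓ ≡ t ++ addr y → ¬ S y

suffixes-comparable : ∀ {a} {A : Set a} (p xs q ys : List A) → p ++ xs ≡ q ++ ys →
                      (∃ λ c → ys ≡ c ++ xs) ⊎ (∃ λ c → xs ≡ c ++ ys)
suffixes-comparable []      xs q       ys eq = inj₂ (q , eq)
suffixes-comparable (x ∷ p) xs []      ys eq = inj₁ (x ∷ p , sym eq)
suffixes-comparable (x ∷ p) xs (y ∷ q) ys eq = suffixes-comparable p xs q ys (∷-injectiveʳ eq)

clear-disjoint : ∀ {r} {S : V r → Set} {xs ys} .{hv : length xs < r} .{hw : length ys < r} p q →
                 S (node one xs hv) → S (node one ys hw) → xs ≢ ys →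
                 ClearBelow S xs (p ++ xs) → ClearBelow S ys (q ++ ys) → p ++ xs ≢ q ++ ys
clear-disjoint p q Sv Sw xs≢ys clear-v clear-w eq with suffixes-comparable p _ q _ eq
... | inj₁ ([]    , ys≡xs) = xs≢ys (sym ys≡xs)
... | inj₁ (_ ∷ _ , ys≡)   = clear-v _ _ q (inj₁ tt) (λ ()) ys≡ eq Sw
... | inj₂ ([]    , xs≡ys) = xs≢ys xs≡ys
... | inj₂ (_ ∷ _ , xs≡)   = clear-w _ _ p (inj₁ tt) (λ ()) xs≡ (sym eq) Sv

-- Read from xs downwards: first d, then b, then `false` until depth r.
leafPath : ℕ → List Bool → List Bool → Bool → List Bool
leafPath r xs d b = replicate (r ∸ suc (length d + length xs)) false ++ b ∷ d

leafPath-depth : ∀ {r} xs d b → suc (length d + length xs) ≤ r → length (leafPath r xs d b ++ xs) ≡ r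
leafPath-depth {r} xs d b fits = begin
  length (leafPath r xs d b ++ xs)                          ≡⟨ length-++ (leafPath r xs d b) ⟩
  length (replicate n false ++ b ∷ d) + length xs            ≡⟨ cong (_+ length xs) (length-++ (replicate n false)) ⟩
  length (replicate n false) + suc (length d) + length xs   ≡⟨ cong (λ m → m + suc (length d) + length xs) (length-replicate n) ⟩
  n + suc (length d) + length xs                            ≡⟨ +-assoc n (suc (length d)) (length xs) ⟩
  n + suc (length d + length xs)                            ≡⟨ m∸n+n≡m fits ⟩
  r                                                         ∎
  where
  open ≡-Reasoning
  n = r ∸ suc (length d + length xs)

leafPath-≢[] : ∀ r xs d b → leafPath r xs d b ≢ []
leafPath-≢[] r xs d b eq with () ← ++-conicalʳ (replicate _ false) (b ∷ d) eq

leafPath-injective : ∀ r xs d → leafPath r xs d false ++ xs ≢ leafPath r xs d true ++ xs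
leafPath-injective r xs d eq
  with () ← ∷-injectiveˡ (++-cancelˡ (replicate _ false) _ _ (++-cancelʳ xs _ _ eq))

record FreeLeaves {r} (S : V r → Set) (xs : List Bool) : Set where
  field
    twig  : List Bool
    fits  : suc (length twig + length xs) ≤ r
    clear : ∀ b → ClearBelow S xs (leafPath r xs twig b ++ xs)

  leaf : Bool → V r
  leaf b = qleaf (leafPath r xs twig b ++ xs) (leafPath-depth xs twig b fits)

  leaf-∉ : ∀ b → ¬ S (leaf b)
  leaf-∉ b = clear b (leaf b) (leafPath r xs twig b) [] (inj₂ tt) (leafPath-≢[] r xs twig b) refl refl

  leaves-distinct : leaf false ≢ leaf true
  leaves-distinct = leafPath-injective r xs twig ∘ cong addr

open FreeLeaves using (leaf)

which : ∀ {a} {A : Set a} (f : Bool → A) {x} → x ≡ f false ⊎ x ≡ f true → ∃ λ b → x ≡ f b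
which f (inj₁ x≡) = false , x≡
which f (inj₂ x≡) = true , x≡

leaves-disjoint : ∀ {r} {S : V r → Set} (v w : V r) → InV1 v → InV1 w → S v → S w → v ≢ w →
                  (P : FreeLeaves S (addr v)) (Q : FreeLeaves S (addr w)) →
                  ∀ x → x ≡ leaf P false ⊎ x ≡ leaf P true → ¬ (x ≡ leaf Q false ⊎ x ≡ leaf Q true)
leaves-disjoint v@(node one _ _) w@(node one _ _) _ _ Sv Sw v≢w P Q x x∈P x∈Q
  with b , refl ← which (leaf P) x∈P | b′ , x≡ ← which (leaf Q) x∈Q =
  clear-disjoint _ _ Sv Sw (v≢w ∘ InV1-addr-injective tt tt)
    (FreeLeaves.clear P b) (FreeLeaves.clear Q b′) (cong addr x≡)

module _ {r} {S : V r → Set} (gp : GeneralPosition S) where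

  between-∉ : ∀ c e a k .(hv : length (e ++ k) < r) .(hs : length (a ++ k) < r) (y : V r) → InT1 y →
           addr y ≡ c ++ e ++ k → c ≢ [] → Diverge (reverse (c ++ e)) (reverse a) → e ++ k ≢ a ++ k →
           S (node one (e ++ k) hv) → S (node one (a ++ k) hs) → ¬ S y
  between-∉ c e a k hv hs y y∈T1 y≡ c≢[] d v≢s Sv Ss Sy with gp y s Sy Ss _ P (dist-shortest P dist≡) v v∈P Sv
    where
    s v : V r
    s = node one (a ++ k) hs
    v = node one (e ++ k) hv
    P : Walk y s (length c + (length e + length a))
    P = ascend c (e ++ k) hv y y∈T1 y≡ ++W
        (ascend e k (k<r hv) v (inj₁ tt) refl ++W reverseW (ascend a k (k<r hv) s (inj₁ tt) refl))
      where k<r : length (e ++ k) < r → length k < r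
            k<r = ≤-trans (s≤s (length-++-≤ʳ k {e}))
    v∈P : v ∈W P
    v∈P = ∈W-++ʳ (ascend c (e ++ k) hv y y∈T1 y≡) (at-start refl)
    dist≡ : dist (fromRoot y) (fromRoot s) ≡ length c + (length e + length a)
    dist≡ = begin
      dist (reverse (addr y)) (reverse (a ++ k))
        ≡⟨ cong (λ zs → dist (reverse zs) (reverse (a ++ k))) (trans y≡ (sym (++-assoc c e k))) ⟩
      dist (reverse ((c ++ e) ++ k)) (reverse (a ++ k)) ≡⟨ dist-branches (c ++ e) a k d ⟩
      length (c ++ e) + length a                         ≡⟨ cong (_+ length a) (length-++ c) ⟩
      length c + length e + length a                     ≡⟨ +-assoc (length c) (length e) (length a) ⟩
      length c + (length e + length a)                   ∎
      where open ≡-Reasoning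
  ... | inj₁ v≡y = c≢[] (++-identityˡ-unique c (trans (cong addr v≡y) y≡))
  ... | inj₂ v≡s = v≢s (cong addr v≡s)

  leaf-path-clear : ∀ p e a k .(hv : length (e ++ k) < r) .(hs : length (a ++ k) < r) →
                    Diverge (reverse (p ++ e)) (reverse a) → e ++ k ≢ a ++ k →
                    S (node one (e ++ k) hv) → S (node one (a ++ k) hs) → ClearBelow S (e ++ k) (p ++ e ++ k)
  leaf-path-clear p e a k hv hs d v≢s Sv Ss y c t y∈T1 c≢[] y≡ ℓ≡ =
    between-∉ c e a k hv hs y y∈T1 y≡ c≢[] (Diverge-++⁻ (reverse t) (subst (λ q → Diverge q (reverse a)) rev≡ d)) v≢s Sv Ss
    where
    p≡ : p ≡ t ++ c
    p≡ = ++-cancelʳ (e ++ k) p (t ++ c) (trans ℓ≡ (trans (cong (t ++_) y≡) (sym (++-assoc t c (e ++ k)))))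
    rev≡ : reverse (p ++ e) ≡ reverse (c ++ e) ++ reverse t
    rev≡ = begin
      reverse (p ++ e)              ≡⟨ cong (λ q → reverse (q ++ e)) p≡ ⟩
      reverse ((t ++ c) ++ e)       ≡⟨ cong reverse (++-assoc t c e) ⟩
      reverse (t ++ (c ++ e))       ≡⟨ reverse-++ t (c ++ e) ⟩
      reverse (c ++ e) ++ reverse t ∎
      where open ≡-Reasoning

  freeLeaves : (v s : V r) → InV1 v → InV1 s → S v → S s → addr v ≢ addr s → FreeLeaves S (addr v)
  freeLeaves (node one xs hv) (node one ys hs) _ _ Sv Ss xs≢ys with position xs ys
  ... | same xs≡ys = ⊥-elim (xs≢ys xs≡ys)
  ... | below zs z refl = record
    { twig  = [ not z ]
    ; fits  = recompute (_ ≤? r) (≤-trans (s≤s xs<ys) hs)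
    ; clear = λ b → leaf-path-clear (leafPath r xs [ not z ] b) [] (zs ∷ʳ z) xs hv hs (away b) xs≢ys Sv Ss
    }
    where
    xs<ys : length xs < length ((zs ∷ʳ z) ++ xs)
    xs<ys = subst (length xs <_) (cong length (sym (∷ʳ-++ zs z xs))) (length-++-≤ʳ (z ∷ xs) {zs})
    away : ∀ b → Diverge (reverse (leafPath r xs [ not z ] b ++ [])) (reverse (zs ∷ʳ z))
    away b = subst₂ Diverge
      (sym (trans (cong reverse (++-identityʳ (leafPath r xs [ not z ] b)))
                  (reverse-++ (replicate (r ∸ suc (1 + length xs)) false) (b ∷ [ not z ]))))
      (sym (reverse-++ zs [ z ]))
      (fork (not-¬ refl ∘ sym))
  ... | apart k e a refl refl e≢[] d = record
    { twig  = []
    ; fits  = recompute (_ ≤? r) hv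
    ; clear = λ b → leaf-path-clear (leafPath r xs [] b) e a k hv hs (away (leafPath r xs [] b)) xs≢ys Sv Ss
    }
    where
    away : ∀ p → Diverge (reverse (p ++ e)) (reverse a)
    away p = subst (λ q → Diverge q (reverse a)) (sym (reverse-++ p e))
                   (Diverge-++⁺ (reverse p) d (e≢[] ∘ reverse-injective))
  freeLeaves (node one _ _) (node two _ _) _ ()
  freeLeaves (node one _ _) (qleaf _ _)    _ ()
  freeLeaves (node two _ _) _              ()
  freeLeaves (qleaf _ _)    _              ()

partner : ∀ {r} {S : V r → Set} {u w : V r} → u ≢ w → S u → InV1 u → S w → InV1 w →
          (v : V r) → Σ (V r) λ s → S s × InV1 s × addr v ≢ addr s
partner {u = u} {w} u≢w Su u∈V1 Sw w∈V1 v with ≡-dec Bool._≟_ (addr v) (addr u)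
... | no  v≢u = u , Su , u∈V1 , v≢u
... | yes v≡u = w , Sw , w∈V1 , λ v≡w → u≢w (InV1-addr-injective u∈V1 w∈V1 (trans (sym v≡u) v≡w))

mainTheorem6 : (r : ℕ) → 2 ≤ r → (S : V r → Set) → GeneralPosition S →
    (Σ (V r) λ u → Σ (V r) λ w → ¬ u ≡ w × S u × InV1 u × S w × InV1 w) →
    Σ ((v : V r) → S v → InV1 v → V r × V r) λ f →
      ((v : V r) (sv : S v) (iv : InV1 v) →
         ¬ proj₁ (f v sv iv) ≡ proj₂ (f v sv iv)
         × IsQuasiLeaf (proj₁ (f v sv iv)) × IsQuasiLeaf (proj₂ (f v sv iv))
         × InSubtree v (proj₁ (f v sv iv)) × InSubtree v (proj₂ (f v sv iv))
         × ¬ S (proj₁ (f v sv iv)) × ¬ S (proj₂ (f v sv iv)))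
      × ((v w : V r) (sv : S v) (iv : InV1 v) (sw : S w) (iw : InV1 w) → ¬ v ≡ w →
         (x : V r) → (x ≡ proj₁ (f v sv iv) ⊎ x ≡ proj₂ (f v sv iv)) →
         ¬ (x ≡ proj₁ (f w sw iw) ⊎ x ≡ proj₂ (f w sw iw)))
-- The hypothesis 2 ≤ r is implied by the existence of two distinct vertices in V_r^(1).
mainTheorem6 r _ S gp (u , w , u≢w , Su , u∈V1 , Sw , w∈V1) =
    (λ v Sv v∈V1 → leaf (F v Sv v∈V1) false , leaf (F v Sv v∈V1) true)
  , (λ { v@(node one _ _) Sv v∈V1 → let open FreeLeaves (F v Sv v∈V1) in
           leaves-distinct , tt , tt , (_ , refl) , (_ , refl) , leaf-∉ false , leaf-∉ true
       ; (node two _ _) _ ()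
       ; (qleaf _ _)    _ () })
  , λ v v′ Sv v∈V1 Sv′ v′∈V1 v≢v′ →
      leaves-disjoint v v′ v∈V1 v′∈V1 Sv Sv′ v≢v′ (F v Sv v∈V1) (F v′ Sv′ v′∈V1)
  where
  F : (v : V r) → S v → InV1 v → FreeLeaves S (addr v)
  F v Sv v∈V1 with s , Ss , s∈V1 , v≢s ← partner u≢w Su u∈V1 Sw w∈V1 v = freeLeaves gp v s v∈V1 s∈V1 Sv Ss v≢s
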